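{- Let $n=p_1\cdots p_k$ with $p_1<\cdots<p_k$ odd primes, $k\ge1$. Fix a sign $\pm$. Let $A,B$ be disjoint sets with $A\uplus B=\underline{n}\setminus\{n\}$, $A\ne\emptyset$, and $\mathcal{C}^{\pm}(B)$ true. Let $u=\min A$, \[ P^{\pm}=\frac{F_{\underline{n}^{\pm}}\,F_{\{n\}^{\mp}}}{F_{\underline{n}^{\mp}}},\qquad G^{\pm}=\frac{F_{B^{\pm}}}{F_{B^{\mp}}}. \] Then $x^{u+1}$ divides $P^{\pm}-R$, where \[ R=\pm\begin{cases}-(-1)^{|A|}G^{\pm}-x^{u}&\text{if }u\in A^{\pm},\\ -(-1)^{|A|}G^{\pm}+x^{u}&\text{if }u\in A^{\mp}.\end{cases} \]
   Context: For a finite set $C$ of positive integers, $F_C=\prod_{c\in C}(x^c-1)$, with $F_\emptyset=1$. For a positive integer $d$, $\overline{d}=\{h:d\mid h\}$ and $\underline{d}=\{h:h\mid d\}$; for a set $B$, $\underline{B}=\bigcup_{d\in B}\underline{d}$ and $B^{\pm}=\{d\in B:\mu(n/d)=\pm1\}$ (likewise $A^\pm$, $\underline{n}^\pm$, $\{n\}^\pm$), where $\mu(d)=(-1)^{\omega(d)}$ for square-free $d$, $\omega(d)$ the number of prime factors. $\mathcal{C}^{\pm}(B)$ means: for all $d\in\underline{B}$, $\#(B^{\pm}\cap\overline d)\ge\#(B^{\mp}\cap\overline d)$. $|A|$ denotes the cardinality of $A$. Divisibility by $x^{u+1}$ is understood for rational functions regular at $x=0$ (equivalently, in the ring of formal power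 series $\mathbb{Z}[[x]]$). -}

module Defs where

open import Data.Nat as ℕ using (ℕ; zero; suc; _∸_; _<_)
open import Data.Nat.DivMod using (_/_)
open import Data.Nat.Divisibility using (_∣_; _∣?_)
open import Data.Nat.Primality using (Prime; prime?)
open import Data.Integer as ℤ using (ℤ; 0ℤ; 1ℤ; -1ℤ)
open import Data.Sign using (Sign; opposite) renaming (+ to pos; - to neg)
open import Data.Sign.Properties using () renaming (_≟_ to _≟ₛ_)
open import Data.List using (List; []; _∷_; filter; upTo; length; foldr; map; zipWith)
open import Data.Bool using (if_then_else_)
open import Relation.Nullary using (does)
open import Relation.Nullary.Decidable using (_×-dec_)
open import Relation.Binary.PropositionalEquality using (_≡_)

Series : Set
Series = ℕ → ℤ

const : ℤ → Series
const c zero    = c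
const c (suc _) = 0ℤ

xpow : ℕ → Series
xpow k m = if does (m ℕ.≟ k) then 1ℤ else 0ℤ

_⊕_ : Series → Series → Series
(f ⊕ g) m = f m ℤ.+ g m

⊝_ : Series → Series
(⊝ f) m = ℤ.- f m

_⊖_ : Series → Series → Series
f ⊖ g = f ⊕ (⊝ g)

_·_ : ℤ → Series → Series
(c · f) m = c ℤ.* f m

sumℤ : List ℤ → ℤ
sumℤ = foldr ℤ._+_ 0ℤ

_⊛_ : Series → Series → Series
(f ⊛ g) m = sumℤ (map (λ i → f i ℤ.* g (m ∸ i)) (upTo (suc m)))

infixl 7 _⊛_ _·_
infixl 6 _⊕_ _⊖_

-- Multiplicative inverse in Z[[x]] of a series whose constant term is a
-- unit (±1) of ℤ.  invRev a m = [b_m, b_{m-1}, …, b_0], where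
-- b_0 = a_0 (= a_0⁻¹ since a_0 = ±1) and
-- b_{m} = - a_0 · Σ_{i=1}^{m} a_i b_{m-i}.
invRev : Series → ℕ → List ℤ
invRev a zero    = a zero ∷ []
invRev a (suc m) =
  let bs = invRev a m in
  (ℤ.- (a zero ℤ.* sumℤ (zipWith ℤ._*_ (map (λ j → a (suc j)) (upTo (suc m))) bs))) ∷ bs

inv : Series → Series
inv a m with invRev a m
... | []    = 0ℤ
... | b ∷ _ = b

F : List ℕ → Series
F []      = const 1ℤ
F (c ∷ C) = (xpow c ⊖ const 1ℤ) ⊛ F C

ω : ℕ → ℕ
ω m = length (filter (λ p → prime? p ×-dec (p ∣? m)) (upTo (suc m)))

signPow : ℕ → Sign
signPow zero    = pos
signPow (suc k) = opposite (signPow k)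

-- μ(m) = (-1)^{ω(m)} (m square-free), recorded as a sign
μsign : ℕ → Sign
μsign m = signPow (ω m)

⟦_⟧ : Sign → ℤ
⟦ pos ⟧ = 1ℤ
⟦ neg ⟧ = -1ℤ

negOnePow : ℕ → ℤ
negOnePow k = ⟦ signPow k ⟧

-- n / d (with n / 0 := 0, never used for d ∣ n, n ≠ 0)
_div_ : ℕ → ℕ → ℕ
n div zero    = 0
n div (suc d) = n / suc d

divisors : ℕ → List ℕ
divisors n = filter (_∣? n) (map suc (upTo n))

-- D^s = { d ∈ D : μ(n/d) = s }   (s = + or -)
signed : ℕ → Sign → List ℕ → List ℕ
signed n s D = filter (λ d → μsign (n div d) ≟ₛ s) D

-- #(D ∩ overline d) = number of elements of D divisible by d
countMultiples : ℕ → List ℕ → ℕ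
countMultiples d D = length (filter (d ∣?_) D)

XPowDivides : ℕ → Series → Set
XPowDivides k f = ∀ m → m < k → f m ≡ 0ℤ

-- Write D = divisors n.  For a list L put E d = x^d − 1 if μ(n/d) = ±1 and
-- E d = (x^d − 1)⁻¹ otherwise, so that F_{L^±}/F_{L^∓} = ∏_{d∈L} E d
-- (quotient≈∏E).  Since D is a rearrangement of n ∷ A ++ B,
--   P^± = (F_{{n}^∓} E n) · ∏_{a∈A} E a · G^±          (factorisation).
-- Modulo x^(u+1), with u = min A < n:
--   * F_{{n}^∓} E n ≡ −(±1), as μ(1) = +              (top-factor);
--   * E a ≡ −1 for a > u, so ∏_A E ≡ −(−1)^|A| E u       (∏E-min);
--   * E u ≡ x^u − 1 or ≡ −(1 + x^u), and x^u G ≡ G₀ x^u   (Closing).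
-- Finally G₀ = (−1)^|B|, and 1 + |A| + |B| = #D is even because d ↦ n/d is a
-- fixed-point-free involution on the divisors of the non-square n
-- (partition-parity), whence (−1)^|A| G₀ = −1, which turns the result into R.
module Submission where

open import Defs
open import Level using (0ℓ)
open import Data.Nat as ℕ using (ℕ; zero; suc; _∸_; _≤_; _<_; z≤n; s≤s)
import Data.Nat.Properties as ℕP
open import Data.Nat.Divisibility using (_∣_; divides; _∣?_; ∣⇒≤; 0∣⇒≡0; ∣1⇒≡1; ∣-refl)
open import Data.Nat.DivMod using (m*n/n≡m; n/n≡1)
open import Data.Nat.Primality using (Prime; euclidsLemma; prime⇒irreducible; prime⇒nonTrivial; productOfPrimes≥1)
open import Data.Nat.ListAction using (product)
open import Data.Nat.Tactic.RingSolver using () renaming (solve-∀ to ℕ-solve-∀)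
open import Data.Integer using (ℤ; 0ℤ; 1ℤ; -1ℤ; _+_; _*_; -_)
import Data.Integer.Properties as ℤP
open import Data.Integer.Tactic.RingSolver using (solve-∀)
open import Data.Sign using (Sign; opposite) renaming (+ to pos; - to neg)
open import Data.Sign.Properties using (opposite-involutive) renaming (_≟_ to _≟ₛ_)
open import Data.List using (List; []; _∷_; _++_; length; applyUpTo; zipWith; map; upTo)
import Data.List.Properties as LP
open import Data.List.Relation.Unary.All using (All; []; _∷_)
import Data.List.Relation.Unary.All as All
import Data.List.Relation.Unary.All.Properties as AllP
open import Data.List.Relation.Unary.Any using (here; there)
open import Data.List.Relation.Unary.AllPairs using (_∷_)
open import Data.List.Relation.Unary.Unique.Propositional using (Unique)
import Data.List.Relation.Unary.Unique.Propositional.Properties as UniqueP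
open import Data.List.Relation.Unary.Linked using (Linked) renaming (_∷_ to _∷ₗ_)
open import Data.List.Relation.Unary.Linked.Properties using (Linked⇒All)
open import Data.List.Membership.Propositional using (_∈_; _∉_)
open import Data.List.Membership.Propositional.Properties using (∈-filter⁺; ∈-filter⁻; ∈-map⁺; ∈-map⁻; ∈-upTo⁺; ∈-++⁺ˡ; ∈-++⁺ʳ; ∈-++⁻)
open import Data.List.Membership.Propositional.Properties.WithK using (unique∧set⇒bag)
open import Data.List.Relation.Binary.Permutation.Propositional as Perm using (_↭_; ↭⇒↭ₛ)
import Data.List.Relation.Binary.Permutation.Propositional.Properties as PermP
open import Relation.Binary.PropositionalEquality.Properties using (setoid)
open import Data.List.Relation.Binary.Permutation.Setoid.Properties (setoid ℕ) using (Unique-resp-↭)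
open import Data.List.Relation.Binary.BagAndSetEquality using (∼bag⇒↭)
open import Data.Product using (_×_; _,_; proj₁; proj₂; ∃-syntax)
open import Data.Sum using (_⊎_; inj₁; inj₂; [_,_])
open import Data.Empty using (⊥-elim)
open import Data.Bool using (if_then_else_)
open import Function.Bundles using (_⇔_; mk⇔; Equivalence)
open import Relation.Nullary using (¬_; Dec; yes; no; does)
open import Relation.Binary.Bundles using (Setoid)
import Relation.Binary.Reasoning.Setoid as SetoidReasoning
open import Relation.Binary.PropositionalEquality using (_≡_; _≢_; refl; sym; trans; cong; cong₂; subst; module ≡-Reasoning)

-- Coefficientwise equality of series, and equality up to degree k,
-- i.e. congruence modulo x^(k+1).
infix 4 _≈_ _≈[_]_
_≈_ : Series → Series → Set
f ≈ g = ∀ m → f m ≡ g m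

_≈[_]_ : Series → ℕ → Series → Set
f ≈[ k ] g = ∀ i → i ≤ k → f i ≡ g i

≈-setoid : Setoid 0ℓ 0ℓ
≈-setoid = record
  { Carrier       = Series
  ; _≈_           = _≈_
  ; isEquivalence = record
    { refl  = λ _ → refl
    ; sym   = λ e m → sym (e m)
    ; trans = λ e e′ m → trans (e m) (e′ m)
    }
  }

≈[]-setoid : ℕ → Setoid 0ℓ 0ℓ
≈[]-setoid k = record
  { Carrier       = Series
  ; _≈_           = _≈[ k ]_
  ; isEquivalence = record
    { refl  = λ _ _ → refl
    ; sym   = λ e i p → sym (e i p)
    ; trans = λ e e′ i p → trans (e i p) (e′ i p)
    }
  }

module ≈-Reasoning = SetoidReasoning ≈-setoid
module ≈[]-Reasoning (k : ℕ) = SetoidReasoning (≈[]-setoid k)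

open Setoid ≈-setoid using () renaming (refl to ≈-refl; sym to ≈-sym; trans to ≈-trans)

≈[]-refl : ∀ {k f} → f ≈[ k ] f
≈[]-refl _ _ = refl

≈⇒≈[] : ∀ {k f g} → f ≈ g → f ≈[ k ] g
≈⇒≈[] e i _ = e i

one : Series
one = const 1ℤ

shift : Series → Series
shift f m = f (suc m)

⊛-zero : ∀ f g → (f ⊛ g) 0 ≡ f 0 * g 0
⊛-zero f g = ℤP.+-identityʳ _

⊛-suc : ∀ f g m → (f ⊛ g) (suc m) ≡ f 0 * g (suc m) + (shift f ⊛ g) m
⊛-suc f g m = cong (λ xs → f 0 * g (suc m) + sumℤ xs)
  (trans (LP.map-applyUpTo suc term (suc m))
         (sym (LP.map-applyUpTo (λ i → i) (λ i → term (suc i)) (suc m))))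
  where
  term : ℕ → ℤ
  term i = f i * g (suc m ∸ i)

-- The coefficient of degree i of a product only involves coefficients of
-- degree ≤ i, so the product respects congruence modulo x^(k+1).
⊛-cong[] : ∀ {k f f′ g g′} → f ≈[ k ] f′ → g ≈[ k ] g′ → f ⊛ g ≈[ k ] f′ ⊛ g′
⊛-cong[] {f = f} {f′} {g} {g′} ef eg zero _ = begin
  (f ⊛ g) 0    ≡⟨ ⊛-zero f g ⟩
  f 0 * g 0    ≡⟨ cong₂ _*_ (ef 0 z≤n) (eg 0 z≤n) ⟩
  f′ 0 * g′ 0  ≡⟨ ⊛-zero f′ g′ ⟨
  (f′ ⊛ g′) 0  ∎
  where open ≡-Reasoning
⊛-cong[] {f = f} {f′} {g} {g′} ef eg (suc i) i<k = begin
  (f ⊛ g) (suc i)                        ≡⟨ ⊛-suc f g i ⟩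
  f 0 * g (suc i) + (shift f ⊛ g) i      ≡⟨ cong₂ _+_ (cong₂ _*_ (ef 0 z≤n) (eg (suc i) i<k)) tail ⟩
  f′ 0 * g′ (suc i) + (shift f′ ⊛ g′) i  ≡⟨ ⊛-suc f′ g′ i ⟨
  (f′ ⊛ g′) (suc i)                      ∎
  where
  open ≡-Reasoning
  i≤k : i ≤ _
  i≤k = ℕP.≤-trans (ℕP.n≤1+n i) i<k
  tail : (shift f ⊛ g) i ≡ (shift f′ ⊛ g′) i
  tail = ⊛-cong[] (λ j j≤i → ef (suc j) (ℕP.≤-trans (s≤s j≤i) i<k))
                  (λ j j≤i → eg j (ℕP.≤-trans j≤i i≤k)) i ℕP.≤-refl

⊛-cong : ∀ {f f′ g g′} → f ≈ f′ → g ≈ g′ → f ⊛ g ≈ f′ ⊛ g′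
⊛-cong ef eg m = ⊛-cong[] (≈⇒≈[] ef) (≈⇒≈[] eg) m ℕP.≤-refl

⊛-congˡ : ∀ {f f′} g → f ≈ f′ → f ⊛ g ≈ f′ ⊛ g
⊛-congˡ g ef = ⊛-cong ef (≈-refl {g})

⊛-congʳ : ∀ f {g g′} → g ≈ g′ → f ⊛ g ≈ f ⊛ g′
⊛-congʳ f eg = ⊛-cong (≈-refl {f}) eg

⊛-distribʳ : ∀ f h g → (f ⊕ h) ⊛ g ≈ f ⊛ g ⊕ h ⊛ g
⊛-distribʳ f h g zero = begin
  (f 0 + h 0) * g 0 + 0ℤ  ≡⟨ ℤP.+-identityʳ _ ⟩
  (f 0 + h 0) * g 0       ≡⟨ ℤP.*-distribʳ-+ (g 0) (f 0) (h 0) ⟩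
  f 0 * g 0 + h 0 * g 0   ≡⟨ cong₂ _+_ (⊛-zero f g) (⊛-zero h g) ⟨
  (f ⊛ g) 0 + (h ⊛ g) 0   ∎
  where open ≡-Reasoning
⊛-distribʳ f h g (suc m) = begin
  ((f ⊕ h) ⊛ g) (suc m)
    ≡⟨ ⊛-suc (f ⊕ h) g m ⟩
  (f 0 + h 0) * g (suc m) + (shift (f ⊕ h) ⊛ g) m
    ≡⟨ cong (λ z → (f 0 + h 0) * g (suc m) + z) (⊛-distribʳ (shift f) (shift h) g m) ⟩
  (f 0 + h 0) * g (suc m) + ((shift f ⊛ g) m + (shift h ⊛ g) m)
    ≡⟨ regroup (f 0) (h 0) (g (suc m)) _ _ ⟩
  (f 0 * g (suc m) + (shift f ⊛ g) m) + (h 0 * g (suc m) + (shift h ⊛ g) m)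
    ≡⟨ cong₂ _+_ (⊛-suc f g m) (⊛-suc h g m) ⟨
  (f ⊛ g) (suc m) + (h ⊛ g) (suc m)  ∎
  where
  open ≡-Reasoning
  regroup : ∀ a b c x y → (a + b) * c + (x + y) ≡ (a * c + x) + (b * c + y)
  regroup = solve-∀

⊛-scalˡ : ∀ c f g → (c · f) ⊛ g ≈ c · (f ⊛ g)
⊛-scalˡ c f g zero = begin
  (c * f 0) * g 0 + 0ℤ  ≡⟨ ℤP.+-identityʳ _ ⟩
  (c * f 0) * g 0       ≡⟨ ℤP.*-assoc c (f 0) (g 0) ⟩
  c * (f 0 * g 0)       ≡⟨ cong (c *_) (⊛-zero f g) ⟨
  c * (f ⊛ g) 0         ∎
  where open ≡-Reasoning
⊛-scalˡ c f g (suc m) = begin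
  ((c · f) ⊛ g) (suc m)                          ≡⟨ ⊛-suc (c · f) g m ⟩
  (c * f 0) * g (suc m) + (shift (c · f) ⊛ g) m  ≡⟨ cong (λ z → (c * f 0) * g (suc m) + z) (⊛-scalˡ c (shift f) g m) ⟩
  (c * f 0) * g (suc m) + c * (shift f ⊛ g) m    ≡⟨ factor c (f 0) (g (suc m)) _ ⟩
  c * (f 0 * g (suc m) + (shift f ⊛ g) m)        ≡⟨ cong (c *_) (⊛-suc f g m) ⟨
  c * (f ⊛ g) (suc m)                            ∎
  where
  open ≡-Reasoning
  factor : ∀ c a b x → (c * a) * b + c * x ≡ c * (a * b + x)
  factor = solve-∀

⊛-assoc : ∀ f g h → (f ⊛ g) ⊛ h ≈ f ⊛ (g ⊛ h)
⊛-assoc f g h zero = begin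
  ((f ⊛ g) ⊛ h) 0    ≡⟨ ⊛-zero (f ⊛ g) h ⟩
  (f ⊛ g) 0 * h 0    ≡⟨ cong (_* h 0) (⊛-zero f g) ⟩
  (f 0 * g 0) * h 0  ≡⟨ ℤP.*-assoc (f 0) (g 0) (h 0) ⟩
  f 0 * (g 0 * h 0)  ≡⟨ cong (f 0 *_) (⊛-zero g h) ⟨
  f 0 * (g ⊛ h) 0    ≡⟨ ⊛-zero f (g ⊛ h) ⟨
  (f ⊛ (g ⊛ h)) 0    ∎
  where open ≡-Reasoning
⊛-assoc f g h (suc m) = begin
  ((f ⊛ g) ⊛ h) (suc m)
    ≡⟨ ⊛-suc (f ⊛ g) h m ⟩
  (f ⊛ g) 0 * h (suc m) + (shift (f ⊛ g) ⊛ h) m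
    ≡⟨ cong₂ _+_ (cong (_* h (suc m)) (⊛-zero f g)) tail ⟩
  (f 0 * g 0) * h (suc m) + (f 0 * (shift g ⊛ h) m + (shift f ⊛ (g ⊛ h)) m)
    ≡⟨ regroup (f 0) (g 0) (h (suc m)) _ _ ⟩
  f 0 * (g 0 * h (suc m) + (shift g ⊛ h) m) + (shift f ⊛ (g ⊛ h)) m
    ≡⟨ cong (λ z → f 0 * z + (shift f ⊛ (g ⊛ h)) m) (⊛-suc g h m) ⟨
  f 0 * (g ⊛ h) (suc m) + (shift f ⊛ (g ⊛ h)) m
    ≡⟨ ⊛-suc f (g ⊛ h) m ⟨
  (f ⊛ (g ⊛ h)) (suc m)  ∎
  where
  open ≡-Reasoning
  regroup : ∀ a b c y z → (a * b) * c + (a * y + z) ≡ a * (b * c + y) + z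
  regroup = solve-∀
  tail : (shift (f ⊛ g) ⊛ h) m ≡ f 0 * (shift g ⊛ h) m + (shift f ⊛ (g ⊛ h)) m
  tail = begin
    (shift (f ⊛ g) ⊛ h) m                            ≡⟨ ⊛-congˡ h (⊛-suc f g) m ⟩
    ((f 0 · shift g ⊕ shift f ⊛ g) ⊛ h) m            ≡⟨ ⊛-distribʳ (f 0 · shift g) (shift f ⊛ g) h m ⟩
    ((f 0 · shift g) ⊛ h) m + ((shift f ⊛ g) ⊛ h) m  ≡⟨ cong₂ _+_ (⊛-scalˡ (f 0) (shift g) h m) (⊛-assoc (shift f) g h m) ⟩
    f 0 * (shift g ⊛ h) m + (shift f ⊛ (g ⊛ h)) m    ∎

⊛-sucʳ : ∀ m f g → (f ⊛ g) (suc m) ≡ f (suc m) * g 0 + (f ⊛ shift g) m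
⊛-sucʳ zero f g = begin
  (f ⊛ g) 1                    ≡⟨ ⊛-suc f g 0 ⟩
  f 0 * g 1 + (shift f ⊛ g) 0  ≡⟨ cong (λ z → f 0 * g 1 + z) (⊛-zero (shift f) g) ⟩
  f 0 * g 1 + f 1 * g 0        ≡⟨ ℤP.+-comm (f 0 * g 1) (f 1 * g 0) ⟩
  f 1 * g 0 + f 0 * g 1        ≡⟨ cong (λ z → f 1 * g 0 + z) (⊛-zero f (shift g)) ⟨
  f 1 * g 0 + (f ⊛ shift g) 0  ∎
  where open ≡-Reasoning
⊛-sucʳ (suc m) f g = begin
  (f ⊛ g) (suc (suc m))
    ≡⟨ ⊛-suc f g (suc m) ⟩
  f 0 * g (suc (suc m)) + (shift f ⊛ g) (suc m)
    ≡⟨ cong (λ z → f 0 * g (suc (suc m)) + z) (⊛-sucʳ m (shift f) g) ⟩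
  f 0 * g (suc (suc m)) + (f (suc (suc m)) * g 0 + (shift f ⊛ shift g) m)
    ≡⟨ swap (f 0 * g (suc (suc m))) (f (suc (suc m)) * g 0) _ ⟩
  f (suc (suc m)) * g 0 + (f 0 * g (suc (suc m)) + (shift f ⊛ shift g) m)
    ≡⟨ cong (λ z → f (suc (suc m)) * g 0 + z) (⊛-suc f (shift g) m) ⟨
  f (suc (suc m)) * g 0 + (f ⊛ shift g) (suc m)  ∎
  where
  open ≡-Reasoning
  swap : ∀ a b x → a + (b + x) ≡ b + (a + x)
  swap = solve-∀

⊛-comm : ∀ f g → f ⊛ g ≈ g ⊛ f
⊛-comm f g zero = begin
  (f ⊛ g) 0  ≡⟨ ⊛-zero f g ⟩
  f 0 * g 0  ≡⟨ ℤP.*-comm (f 0) (g 0) ⟩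
  g 0 * f 0  ≡⟨ ⊛-zero g f ⟨
  (g ⊛ f) 0  ∎
  where open ≡-Reasoning
⊛-comm f g (suc m) = begin
  (f ⊛ g) (suc m)                    ≡⟨ ⊛-suc f g m ⟩
  f 0 * g (suc m) + (shift f ⊛ g) m  ≡⟨ cong₂ _+_ (ℤP.*-comm (f 0) (g (suc m))) (⊛-comm (shift f) g m) ⟩
  g (suc m) * f 0 + (g ⊛ shift f) m  ≡⟨ ⊛-sucʳ m g f ⟨
  (g ⊛ f) (suc m)                    ∎
  where open ≡-Reasoning

⊛-zeroˡ : ∀ g → (λ _ → 0ℤ) ⊛ g ≈ (λ _ → 0ℤ)
⊛-zeroˡ g zero    = ⊛-zero (λ _ → 0ℤ) g
⊛-zeroˡ g (suc m) = trans (⊛-suc (λ _ → 0ℤ) g m) (trans (ℤP.+-identityˡ _) (⊛-zeroˡ g m))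

⊛-constˡ : ∀ c g → const c ⊛ g ≈ c · g
⊛-constˡ c g zero = ⊛-zero (const c) g
⊛-constˡ c g (suc m) = begin
  (const c ⊛ g) (suc m)               ≡⟨ ⊛-suc (const c) g m ⟩
  c * g (suc m) + ((λ _ → 0ℤ) ⊛ g) m  ≡⟨ cong (λ z → c * g (suc m) + z) (⊛-zeroˡ g m) ⟩
  c * g (suc m) + 0ℤ                  ≡⟨ ℤP.+-identityʳ _ ⟩
  c * g (suc m)                       ∎
  where open ≡-Reasoning

⊛-identityˡ : ∀ g → one ⊛ g ≈ g
⊛-identityˡ g m = trans (⊛-constˡ 1ℤ g m) (ℤP.*-identityˡ (g m))

⊛-identityʳ : ∀ g → g ⊛ one ≈ g
⊛-identityʳ g m = trans (⊛-comm g one m) (⊛-identityˡ g m)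

⊛-swap : ∀ x y z → x ⊛ (y ⊛ z) ≈ y ⊛ (x ⊛ z)
⊛-swap x y z = begin
  x ⊛ (y ⊛ z)  ≈⟨ ⊛-assoc x y z ⟨
  (x ⊛ y) ⊛ z  ≈⟨ ⊛-congˡ z (⊛-comm x y) ⟩
  (y ⊛ x) ⊛ z  ≈⟨ ⊛-assoc y x z ⟩
  y ⊛ (x ⊛ z)  ∎
  where open ≈-Reasoning

⊛-interchange : ∀ x y z w → (x ⊛ y) ⊛ (z ⊛ w) ≈ (x ⊛ z) ⊛ (y ⊛ w)
⊛-interchange x y z w = begin
  (x ⊛ y) ⊛ (z ⊛ w)  ≈⟨ ⊛-assoc x y (z ⊛ w) ⟩
  x ⊛ (y ⊛ (z ⊛ w))  ≈⟨ ⊛-congʳ x (⊛-swap y z w) ⟩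
  x ⊛ (z ⊛ (y ⊛ w))  ≈⟨ ⊛-assoc x z (y ⊛ w) ⟨
  (x ⊛ z) ⊛ (y ⊛ w)  ∎
  where open ≈-Reasoning

⊕-cong[] : ∀ {k f f′ g g′} → f ≈[ k ] f′ → g ≈[ k ] g′ → f ⊕ g ≈[ k ] f′ ⊕ g′
⊕-cong[] ef eg i p = cong₂ _+_ (ef i p) (eg i p)

·-cong[] : ∀ {k f g} c → f ≈[ k ] g → c · f ≈[ k ] c · g
·-cong[] c e i p = cong (c *_) (e i p)

IsUnit : Series → Set
IsUnit a = a 0 * a 0 ≡ 1ℤ

zipWith-applyUpTo : ∀ (f g : ℕ → ℤ) k →
  zipWith _*_ (applyUpTo f k) (applyUpTo g k) ≡ applyUpTo (λ i → f i * g i) k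
zipWith-applyUpTo f g zero    = refl
zipWith-applyUpTo f g (suc k) =
  cong (f 0 * g 0 ∷_) (zipWith-applyUpTo (λ i → f (suc i)) (λ i → g (suc i)) k)

invRev-applyUpTo : ∀ a m → invRev a m ≡ applyUpTo (λ i → inv a (m ∸ i)) (suc m)
invRev-applyUpTo a zero    = refl
invRev-applyUpTo a (suc m) = cong (inv a (suc m) ∷_) (invRev-applyUpTo a m)

inv-suc : ∀ a m → inv a (suc m) ≡ - (a 0 * (shift a ⊛ inv a) m)
inv-suc a m = cong (λ xs → - (a 0 * sumℤ xs)) (begin
  zipWith _*_ (map (λ j → a (suc j)) (upTo (suc m))) (invRev a m)
    ≡⟨ cong₂ (zipWith _*_) (LP.map-applyUpTo (λ i → i) (λ j → a (suc j)) (suc m)) (invRev-applyUpTo a m) ⟩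
  zipWith _*_ (applyUpTo (λ j → a (suc j)) (suc m)) (applyUpTo (λ i → inv a (m ∸ i)) (suc m))
    ≡⟨ zipWith-applyUpTo (λ j → a (suc j)) (λ i → inv a (m ∸ i)) (suc m) ⟩
  applyUpTo (λ i → a (suc i) * inv a (m ∸ i)) (suc m)
    ≡⟨ LP.map-applyUpTo (λ i → i) (λ i → a (suc i) * inv a (m ∸ i)) (suc m) ⟨
  map (λ i → a (suc i) * inv a (m ∸ i)) (upTo (suc m))  ∎)
  where open ≡-Reasoning

inv-inverseʳ : ∀ a → IsUnit a → a ⊛ inv a ≈ one
inv-inverseʳ a a-unit zero    = trans (⊛-zero a (inv a)) a-unit
inv-inverseʳ a a-unit (suc m) = begin
  (a ⊛ inv a) (suc m)      ≡⟨ ⊛-suc a (inv a) m ⟩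
  a 0 * inv a (suc m) + S  ≡⟨ cong (λ z → a 0 * z + S) (inv-suc a m) ⟩
  a 0 * - (a 0 * S) + S    ≡⟨ cancel (a 0) S ⟩
  - ((a 0 * a 0) * S) + S  ≡⟨ cong (λ z → - (z * S) + S) a-unit ⟩
  - (1ℤ * S) + S           ≡⟨ cong (λ z → - z + S) (ℤP.*-identityˡ S) ⟩
  - S + S                  ≡⟨ ℤP.+-inverseˡ S ⟩
  0ℤ                       ∎
  where
  open ≡-Reasoning
  S : ℤ
  S = (shift a ⊛ inv a) m
  cancel : ∀ a S → a * - (a * S) + S ≡ - ((a * a) * S) + S
  cancel = solve-∀

inv-inverseˡ : ∀ a → IsUnit a → inv a ⊛ a ≈ one
inv-inverseˡ a a-unit m = trans (⊛-comm (inv a) a m) (inv-inverseʳ a a-unit m)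

inv-unique[] : ∀ {k c z} → IsUnit c → c ⊛ z ≈[ k ] one → inv c ≈[ k ] z
inv-unique[] {k} {c} {z} c-unit cz≈1 = begin
  inv c            ≈⟨ ≈⇒≈[] (⊛-identityʳ (inv c)) ⟨
  inv c ⊛ one      ≈⟨ ⊛-cong[] {f = inv c} ≈[]-refl cz≈1 ⟨
  inv c ⊛ (c ⊛ z)  ≈⟨ ≈⇒≈[] (⊛-assoc (inv c) c z) ⟨
  (inv c ⊛ c) ⊛ z  ≈⟨ ≈⇒≈[] (⊛-congˡ z (inv-inverseˡ c c-unit)) ⟩
  one ⊛ z          ≈⟨ ≈⇒≈[] (⊛-identityˡ z) ⟩
  z                ∎
  where open ≈[]-Reasoning k

IsUnit-⊛ : ∀ {a b} → IsUnit a → IsUnit b → IsUnit (a ⊛ b)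
IsUnit-⊛ {a} {b} a-unit b-unit = begin
  (a ⊛ b) 0 * (a ⊛ b) 0      ≡⟨ cong (λ z → z * z) (⊛-zero a b) ⟩
  (a 0 * b 0) * (a 0 * b 0)  ≡⟨ interchange (a 0) (b 0) ⟩
  (a 0 * a 0) * (b 0 * b 0)  ≡⟨ cong₂ _*_ a-unit b-unit ⟩
  1ℤ                         ∎
  where
  open ≡-Reasoning
  interchange : ∀ x y → (x * y) * (x * y) ≡ (x * x) * (y * y)
  interchange = solve-∀

inv-⊛ : ∀ {a b} → IsUnit a → IsUnit b → inv (a ⊛ b) ≈ inv a ⊛ inv b
inv-⊛ {a} {b} a-unit b-unit m = inv-unique[] (IsUnit-⊛ {a} {b} a-unit b-unit) (≈⇒≈[] product≈1) m ℕP.≤-refl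
  where
  open ≈-Reasoning
  product≈1 : (a ⊛ b) ⊛ (inv a ⊛ inv b) ≈ one
  product≈1 = begin
    (a ⊛ b) ⊛ (inv a ⊛ inv b)  ≈⟨ ⊛-interchange a b (inv a) (inv b) ⟩
    (a ⊛ inv a) ⊛ (b ⊛ inv b)  ≈⟨ ⊛-cong (inv-inverseʳ a a-unit) (inv-inverseʳ b b-unit) ⟩
    one ⊛ one                  ≈⟨ ⊛-identityˡ one ⟩
    one                        ∎

xpow-below : ∀ u i → i < u → xpow u i ≡ 0ℤ
xpow-below (suc u) zero    _         = refl
xpow-below (suc u) (suc i) (s≤s i<u) = xpow-below u i i<u

xpow-⊛ : ∀ u g → xpow u ⊛ g ≈[ u ] g 0 · xpow u
xpow-⊛ zero    g zero    _         = trans (⊛-zero (xpow 0) g) (ℤP.*-comm 1ℤ (g 0))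
xpow-⊛ (suc u) g zero    _         = trans (⊛-zero (xpow (suc u)) g) (trans (ℤP.*-zeroˡ (g 0)) (sym (ℤP.*-zeroʳ (g 0))))
xpow-⊛ (suc u) g (suc i) (s≤s i≤u) = begin
  (xpow (suc u) ⊛ g) (suc i)       ≡⟨ ⊛-suc (xpow (suc u)) g i ⟩
  0ℤ * g (suc i) + (xpow u ⊛ g) i  ≡⟨ cong (_+ (xpow u ⊛ g) i) (ℤP.*-zeroˡ (g (suc i))) ⟩
  0ℤ + (xpow u ⊛ g) i              ≡⟨ ℤP.+-identityˡ _ ⟩
  (xpow u ⊛ g) i                   ≡⟨ xpow-⊛ u g i i≤u ⟩
  g 0 * xpow u i                   ∎
  where open ≡-Reasoning

fac : ℕ → Series
fac d = xpow d ⊖ one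

IsUnit-fac : ∀ d → 1 ≤ d → IsUnit (fac d)
IsUnit-fac (suc d) _ = refl

IsUnit-F : ∀ {L} → All (1 ≤_) L → IsUnit (F L)
IsUnit-F []                = refl
IsUnit-F {d ∷ L} (d≥1 ∷ L≥1) = IsUnit-⊛ {fac d} {F L} (IsUnit-fac d d≥1) (IsUnit-F L≥1)

fac-⊛ : ∀ d g → fac d ⊛ g ≈ xpow d ⊛ g ⊖ g
fac-⊛ d g m = begin
  (fac d ⊛ g) m                     ≡⟨ ⊛-distribʳ (xpow d) (⊝ one) g m ⟩
  (xpow d ⊛ g) m + ((⊝ one) ⊛ g) m  ≡⟨ cong ((xpow d ⊛ g) m +_) minus-one ⟩
  (xpow d ⊛ g) m + - g m            ∎
  where
  open ≡-Reasoning
  ⊝one≈-1 : ⊝ one ≈ const -1ℤ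
  ⊝one≈-1 zero    = refl
  ⊝one≈-1 (suc _) = refl
  minus-one : ((⊝ one) ⊛ g) m ≡ - g m
  minus-one = trans (⊛-congˡ g ⊝one≈-1 m) (trans (⊛-constˡ -1ℤ g m) (ℤP.-1*i≡-i (g m)))

fac-⊛[] : ∀ u g → fac u ⊛ g ≈[ u ] g 0 · xpow u ⊖ g
fac-⊛[] u g = begin
  fac u ⊛ g         ≈⟨ ≈⇒≈[] (fac-⊛ u g) ⟩
  xpow u ⊛ g ⊖ g    ≈⟨ ⊕-cong[] (xpow-⊛ u g) ≈[]-refl ⟩
  g 0 · xpow u ⊖ g  ∎
  where open ≈[]-Reasoning u

fac-high : ∀ u d → u < d → fac d ≈[ u ] const -1ℤ
fac-high u d u<d i i≤u = trans (cong (_+ - one i) (xpow-below d i (ℕP.≤-<-trans i≤u u<d))) (minus-one i)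
  where
  minus-one : ∀ i → 0ℤ + - one i ≡ const -1ℤ i
  minus-one zero    = refl
  minus-one (suc _) = refl

inv-fac-high : ∀ u d → u < d → inv (fac d) ≈[ u ] const -1ℤ
inv-fac-high u d u<d = inv-unique[] (IsUnit-fac d (ℕP.≤-trans (s≤s z≤n) u<d)) product≈1
  where
  square : ∀ i → -1ℤ * const -1ℤ i ≡ one i
  square zero    = refl
  square (suc _) = refl
  product≈1 : fac d ⊛ const -1ℤ ≈[ u ] one
  product≈1 i i≤u = begin
    (fac d ⊛ const -1ℤ) i  ≡⟨ ⊛-comm (fac d) (const -1ℤ) i ⟩
    (const -1ℤ ⊛ fac d) i  ≡⟨ ⊛-constˡ -1ℤ (fac d) i ⟩
    -1ℤ * fac d i          ≡⟨ cong (-1ℤ *_) (fac-high u d u<d i i≤u) ⟩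
    -1ℤ * const -1ℤ i      ≡⟨ square i ⟩
    one i                  ∎
    where open ≡-Reasoning

inv-fac-low : ∀ u → 1 ≤ u → inv (fac u) ≈[ u ] -1ℤ · (one ⊕ xpow u)
inv-fac-low u@(suc _) _ = inv-unique[] (IsUnit-fac u (s≤s z≤n)) (begin
  fac u ⊛ W         ≈⟨ fac-⊛[] u W ⟩
  -1ℤ · xpow u ⊖ W  ≈⟨ ≈⇒≈[] (λ i → cancel (xpow u i) (one i)) ⟩
  one               ∎)
  where
  open ≈[]-Reasoning u
  W : Series
  W = -1ℤ · (one ⊕ xpow u)
  cancel : ∀ X o → -1ℤ * X + - (-1ℤ * (o + X)) ≡ o
  cancel = solve-∀

⟦opposite⟧ : ∀ x → ⟦ opposite x ⟧ ≡ -1ℤ * ⟦ x ⟧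
⟦opposite⟧ pos = refl
⟦opposite⟧ neg = refl

-⟦opposite⟧ : ∀ x → - ⟦ opposite x ⟧ ≡ ⟦ x ⟧
-⟦opposite⟧ pos = refl
-⟦opposite⟧ neg = refl

negOnePow-suc : ∀ k → negOnePow (suc k) ≡ -1ℤ * negOnePow k
negOnePow-suc k = ⟦opposite⟧ (signPow k)

negOnePow-suc-suc : ∀ k → negOnePow (suc (suc k)) ≡ negOnePow k
negOnePow-suc-suc k = cong ⟦_⟧ (opposite-involutive (signPow k))

negOnePow-+ : ∀ a b → negOnePow (a ℕ.+ b) ≡ negOnePow a * negOnePow b
negOnePow-+ zero    b = sym (ℤP.*-identityˡ (negOnePow b))
negOnePow-+ (suc a) b = begin
  negOnePow (suc (a ℕ.+ b))          ≡⟨ negOnePow-suc (a ℕ.+ b) ⟩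
  -1ℤ * negOnePow (a ℕ.+ b)          ≡⟨ cong (-1ℤ *_) (negOnePow-+ a b) ⟩
  -1ℤ * (negOnePow a * negOnePow b)  ≡⟨ ℤP.*-assoc -1ℤ (negOnePow a) (negOnePow b) ⟨
  (-1ℤ * negOnePow a) * negOnePow b  ≡⟨ cong (_* negOnePow b) (negOnePow-suc a) ⟨
  negOnePow (suc a) * negOnePow b    ∎
  where open ≡-Reasoning

opposite-parities : ∀ a b → negOnePow (suc (a ℕ.+ b)) ≡ 1ℤ → negOnePow a * negOnePow b ≡ -1ℤ
opposite-parities a b even = begin
  negOnePow a * negOnePow b          ≡⟨ negOnePow-+ a b ⟨
  negOnePow (a ℕ.+ b)                ≡⟨ double-negation (negOnePow (a ℕ.+ b)) ⟩
  -1ℤ * (-1ℤ * negOnePow (a ℕ.+ b))  ≡⟨ cong (-1ℤ *_) (negOnePow-suc (a ℕ.+ b)) ⟨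
  -1ℤ * negOnePow (suc (a ℕ.+ b))    ≡⟨ cong (-1ℤ *_) even ⟩
  -1ℤ                                ∎
  where
  open ≡-Reasoning
  double-negation : ∀ x → x ≡ -1ℤ * (-1ℤ * x)
  double-negation = solve-∀

≢⇒opposite : ∀ {x s} → x ≢ s → x ≡ opposite s
≢⇒opposite {pos} {pos} x≢s = ⊥-elim (x≢s refl)
≢⇒opposite {pos} {neg} _   = refl
≢⇒opposite {neg} {pos} _   = refl
≢⇒opposite {neg} {neg} x≢s = ⊥-elim (x≢s refl)

≡⇒≢opposite : ∀ {x s} → x ≡ s → x ≢ opposite s
≡⇒≢opposite {pos} refl ()
≡⇒≢opposite {neg} refl ()

∈divisors⁺ : ∀ {n d} → 1 ≤ n → d ∣ n → d ∈ divisors n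
∈divisors⁺ {suc n} {zero}  _ 0∣n with () ← 0∣⇒≡0 0∣n
∈divisors⁺ {suc n} {suc d} _ d∣n = ∈-filter⁺ (_∣? suc n) (∈-map⁺ suc (∈-upTo⁺ (∣⇒≤ d∣n))) d∣n

∈divisors⁻ : ∀ {n d} → d ∈ divisors n → d ∣ n × 1 ≤ d
∈divisors⁻ {n} p with ∈-filter⁻ (_∣? n) {xs = map suc (upTo n)} p
... | q , d∣n with ∈-map⁻ suc q
...   | _ , _ , refl = d∣n , s≤s z≤n

divisors-unique : ∀ n → Unique (divisors n)
divisors-unique n = UniqueP.filter⁺ (_∣? n) (UniqueP.map⁺ ℕP.suc-injective (UniqueP.upTo⁺ n))

div-cofactor : ∀ {n d} → 1 ≤ n → (d∣n : d ∣ n) → n div d ≡ _∣_.quotient d∣n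
div-cofactor {d = zero}  n≥1 (divides q refl) with () ← ℕP.≤-trans n≥1 (ℕP.≤-reflexive (ℕP.*-zeroʳ q))
div-cofactor {d = suc d} _   (divides q refl) = m*n/n≡m q (suc d)

divisors-positive : ∀ n → All (1 ≤_) (divisors n)
divisors-positive n = All.tabulate (λ p → proj₂ (∈divisors⁻ {n} p))

divisor≥1 : ∀ {n d} → 1 ≤ n → d ∣ n → 1 ≤ d
divisor≥1 {n} n≥1 d∣n = proj₂ (∈divisors⁻ {n} (∈divisors⁺ n≥1 d∣n))

divisors↭ : ∀ {n A B} → 1 ≤ n → Unique A → Unique B → (∀ d → d ∈ A → d ∉ B) →
            (∀ d → (d ∈ A ⊎ d ∈ B) ⇔ (d ∣ n × d ≢ n)) →
            divisors n ↭ n ∷ A ++ B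
divisors↭ {n} {A} {B} n≥1 uniqueA uniqueB disjoint partition =
  ∼bag⇒↭ (unique∧set⇒bag (divisors-unique n) unique (λ {d} → mk⇔ (to d) (from d)))
  where
  proper : ∀ d → d ∈ A ++ B → d ∣ n × d ≢ n
  proper d p = Equivalence.to (partition d) (∈-++⁻ A p)
  unique : Unique (n ∷ A ++ B)
  unique = All.tabulate (λ {d} p n≡d → proj₂ (proper d p) (sym n≡d))
         ∷ UniqueP.++⁺ uniqueA uniqueB (λ (a , b) → disjoint _ a b)
  to : ∀ d → d ∈ divisors n → d ∈ n ∷ A ++ B
  to d p with d ℕ.≟ n
  ... | yes d≡n = here d≡n
  ... | no  d≢n = there ([ ∈-++⁺ˡ , ∈-++⁺ʳ A ] (Equivalence.from (partition d) (proj₁ (∈divisors⁻ p) , d≢n)))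
  from : ∀ d → d ∈ n ∷ A ++ B → d ∈ divisors n
  from d (here refl) = ∈divisors⁺ n≥1 ∣-refl
  from d (there p)   = ∈divisors⁺ n≥1 (proj₁ (proper d p))

prime∤product : ∀ {q} qs → Prime q → All Prime qs → All (q <_) qs → ¬ q ∣ product qs
prime∤product [] q-prime [] [] q∣1 = ℕ.nonTrivial⇒≢1 {{prime⇒nonTrivial q-prime}} (∣1⇒≡1 q∣1)
prime∤product {q} (r ∷ rs) q-prime (r-prime ∷ rs-prime) (q<r ∷ q<rs) q∣rrs
  with euclidsLemma r (product rs) q-prime q∣rrs
... | inj₂ q∣rs = prime∤product rs q-prime rs-prime q<rs q∣rs
... | inj₁ q∣r with prime⇒irreducible r-prime q∣r
...   | inj₁ q≡1 = ℕ.nonTrivial⇒≢1 {{prime⇒nonTrivial q-prime}} q≡1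
...   | inj₂ q≡r = ℕP.<-irrefl q≡r q<r

smallest-first : ∀ {q qs} → Linked _<_ (q ∷ qs) → All (q <_) qs
smallest-first {qs = []}    _                  = []
smallest-first {qs = _ ∷ _} (q<r ∷ₗ increasing) = Linked⇒All ℕP.<-trans q<r increasing

-- A nonempty product of strictly increasing primes is not a square: its
-- smallest prime q would divide d, so q² ∣ d², so q would divide the
-- product of the remaining primes.
squarefree-not-square : ∀ {ps} → ps ≢ [] → All Prime ps → Linked _<_ ps → ∀ d → d ℕ.* d ≢ product ps
squarefree-not-square {[]}     ps≢[] _ _ _ _ = ps≢[] refl
squarefree-not-square {q ∷ qs} _ (q-prime ∷ qs-prime) increasing d d²≡ =
  q∤d ([ (λ h → h) , (λ h → h) ] (euclidsLemma d d q-prime (divides (product qs) (trans d²≡ (ℕP.*-comm q (product qs))))))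
  where
  q<qs : All (q <_) qs
  q<qs = smallest-first increasing
  regroup : ∀ k q → (k ℕ.* q) ℕ.* (k ℕ.* q) ≡ q ℕ.* ((k ℕ.* k) ℕ.* q)
  regroup = ℕ-solve-∀
  q∤d : ¬ q ∣ d
  q∤d (divides k refl) = prime∤product qs q-prime qs-prime q<qs
    (divides (k ℕ.* k) (sym (ℕP.*-cancelˡ-≡ ((k ℕ.* k) ℕ.* q) (product qs) q
      {{ℕ.nonTrivial⇒nonZero q {{prime⇒nonTrivial q-prime}}}} (trans (sym (regroup k q)) d²≡))))

∈⇒↭∷ : ∀ {x : ℕ} {L} → x ∈ L → ∃[ L′ ] (L ↭ x ∷ L′)
∈⇒↭∷ {L = _ ∷ L} (here refl) = L , Perm.refl
∈⇒↭∷ {x} {L = y ∷ _} (there p) with L′ , L↭ ← ∈⇒↭∷ p =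
  y ∷ L′ , Perm.trans (Perm.prep y L↭) (Perm.swap y x Perm.refl)

record FreeInvolution (σ : ℕ → ℕ) (L : List ℕ) : Set where
  field
    closed        : ∀ {x} → x ∈ L → σ x ∈ L
    involutive    : ∀ {x} → x ∈ L → σ (σ x) ≡ x
    fixpoint-free : ∀ {x} → x ∈ L → σ x ≢ x

remove-orbit : ∀ {σ x L} → Unique (x ∷ L) → FreeInvolution σ (x ∷ L) →
               ∃[ L′ ] (L ↭ σ x ∷ L′ × Unique L′ × FreeInvolution σ L′)
remove-orbit {σ} {x} {L} unique fi = L′ , L↭ , unique′ , record
  { closed        = closed′
  ; involutive    = λ p → involutive (back p)
  ; fixpoint-free = λ p → fixpoint-free (back p)
  }
  where
  open FreeInvolution fi
  σx∈L : σ x ∈ L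
  σx∈L with closed (here refl)
  ... | here σx≡x = ⊥-elim (fixpoint-free (here refl) σx≡x)
  ... | there p   = p
  L′ = proj₁ (∈⇒↭∷ σx∈L)
  L↭ = proj₂ (∈⇒↭∷ σx∈L)
  xL↭ : x ∷ L ↭ x ∷ σ x ∷ L′
  xL↭ = Perm.prep x L↭
  unique″ : Unique (x ∷ σ x ∷ L′)
  unique″ = Unique-resp-↭ (↭⇒↭ₛ xL↭) unique
  unique′ : Unique L′
  unique′ with _ ∷ _ ∷ u ← unique″ = u
  back : ∀ {y} → y ∈ L′ → y ∈ x ∷ L
  back p = PermP.∈-resp-↭ (Perm.↭-sym xL↭) (there (there p))
  closed′ : ∀ {y} → y ∈ L′ → σ y ∈ L′
  closed′ {y} p with PermP.∈-resp-↭ xL↭ (closed (back p)) | unique″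
  -- σ y = x forces y = σ x, and σ y = σ x forces y = x; neither lies in L′.
  ... | here σy≡x          | _ ∷ σx∉ ∷ _ = ⊥-elim (All.lookup σx∉ p
          (trans (cong σ (sym σy≡x)) (involutive (back p))))
  ... | there (here σy≡σx) | x∉ ∷ _      = ⊥-elim (All.lookup x∉ (there p)
          (trans (sym (involutive (here refl))) (trans (cong σ (sym σy≡σx)) (involutive (back p)))))
  ... | there (there q)    | _           = q

-- A duplicate-free list carrying a fixed-point-free involution splits
-- into orbits of size two, so its length is even.
involution-even : ∀ σ L → Unique L → FreeInvolution σ L → negOnePow (length L) ≡ 1ℤ
involution-even σ L = go (length L) L ℕP.≤-refl
  where
  -- induction on an upper bound k for the length, as each step removes two elements
  go : ∀ k L → length L ≤ k → Unique L → FreeInvolution σ L → negOnePow (length L) ≡ 1ℤ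
  go _       []      _         _      _  = refl
  go (suc k) (x ∷ L) (s≤s |L|≤k) unique fi with L′ , L↭ , unique′ , fi′ ← remove-orbit unique fi = begin
    negOnePow (suc (length L))         ≡⟨ cong (λ m → negOnePow (suc m)) (PermP.↭-length L↭) ⟩
    negOnePow (suc (suc (length L′)))  ≡⟨ negOnePow-suc-suc (length L′) ⟩
    negOnePow (length L′)              ≡⟨ go k L′ |L′|≤k unique′ fi′ ⟩
    1ℤ                                 ∎
    where
    open ≡-Reasoning
    |L′|≤k : length L′ ≤ k
    |L′|≤k = ℕP.≤-trans (ℕP.n≤1+n _) (subst (_≤ k) (PermP.↭-length L↭) |L|≤k)

-- A number n ≥ 1 that is not a square has an even number of divisors,
-- since d ↦ n/d is a fixed-point-free involution on them.
divisors-even : ∀ {n} → 1 ≤ n → (∀ d → d ℕ.* d ≢ n) → negOnePow (length (divisors n)) ≡ 1ℤ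
divisors-even {n} n≥1 not-square =
  involution-even (n div_) (divisors n) (divisors-unique n) record
    { closed        = λ p → ∈divisors⁺ n≥1 (cofactor∣n (divisor p))
    ; involutive    = λ p → cofactor-involutive (divisor p)
    ; fixpoint-free = λ p → cofactor≢self (divisor p)
    }
  where
  divisor : ∀ {d} → d ∈ divisors n → d ∣ n
  divisor p = proj₁ (∈divisors⁻ p)
  cofactor∣n : ∀ {d} → d ∣ n → n div d ∣ n
  cofactor∣n {d} d∣n@(divides q n≡qd) =
    subst (_∣ n) (sym (div-cofactor n≥1 d∣n)) (divides d (trans n≡qd (ℕP.*-comm q d)))
  cofactor-involutive : ∀ {d} → d ∣ n → n div (n div d) ≡ d
  cofactor-involutive {d} d∣n@(divides q n≡qd) =
    trans (cong (n div_) (div-cofactor n≥1 d∣n)) (div-cofactor n≥1 (divides d (trans n≡qd (ℕP.*-comm q d))))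
  cofactor≢self : ∀ {d} → d ∣ n → n div d ≢ d
  cofactor≢self {d} d∣n@(divides q n≡qd) cofactor≡d =
    not-square d (sym (trans n≡qd (cong (ℕ._* d) (trans (sym (div-cofactor n≥1 d∣n)) cofactor≡d))))

partition-parity : ∀ {n A B} → 1 ≤ n → (∀ d → d ℕ.* d ≢ n) → divisors n ↭ n ∷ A ++ B →
                   negOnePow (length A) * negOnePow (length B) ≡ -1ℤ
partition-parity {n} {A} {B} n≥1 not-square D↭ = opposite-parities (length A) (length B) (begin
  negOnePow (suc (length A ℕ.+ length B))  ≡⟨ cong (λ m → negOnePow (suc m)) (LP.length-++ A) ⟨
  negOnePow (length (n ∷ A ++ B))          ≡⟨ cong negOnePow (PermP.↭-length D↭) ⟨
  negOnePow (length (divisors n))          ≡⟨ divisors-even n≥1 not-square ⟩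
  1ℤ                                       ∎)
  where open ≡-Reasoning

signed-accept : ∀ n {t d L} → μsign (n div d) ≡ t → signed n t (d ∷ L) ≡ d ∷ signed n t L
signed-accept n {t} {d} {L} = LP.filter-accept (λ d → μsign (n div d) ≟ₛ t) {d} {L}

signed-reject : ∀ n {t d L} → μsign (n div d) ≢ t → signed n t (d ∷ L) ≡ signed n t L
signed-reject n {t} {d} {L} = LP.filter-reject (λ d → μsign (n div d) ≟ₛ t) {d} {L}

module SignedFactors (n : ℕ) (s : Sign) where

  E : ℕ → Series
  E d with μsign (n div d) ≟ₛ s
  ... | yes _ = fac d
  ... | no  _ = inv (fac d)

  E-accept : ∀ d → μsign (n div d) ≡ s → E d ≡ fac d
  E-accept d μ≡s with μsign (n div d) ≟ₛ s
  ... | yes _   = refl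
  ... | no  μ≢s = ⊥-elim (μ≢s μ≡s)

  E-reject : ∀ d → μsign (n div d) ≢ s → E d ≡ inv (fac d)
  E-reject d μ≢s with μsign (n div d) ≟ₛ s
  ... | yes μ≡s = ⊥-elim (μ≢s μ≡s)
  ... | no  _   = refl

  E-constant : ∀ d → 1 ≤ d → E d 0 ≡ -1ℤ
  E-constant (suc d) _ with μsign (n div suc d) ≟ₛ s
  ... | yes _ = refl
  ... | no  _ = refl

  E-high : ∀ u d → u < d → E d ≈[ u ] const -1ℤ
  E-high u d u<d with μsign (n div d) ≟ₛ s
  ... | yes _ = fac-high u d u<d
  ... | no  _ = inv-fac-high u d u<d

  ∏E : List ℕ → Series
  ∏E []      = one
  ∏E (d ∷ L) = E d ⊛ ∏E L

  quotient≈∏E : ∀ {L} → All (1 ≤_) L → F (signed n s L) ⊛ inv (F (signed n (opposite s) L)) ≈ ∏E L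
  quotient≈∏E []                = inv-inverseʳ one refl
  quotient≈∏E {d ∷ L} (d≥1 ∷ L≥1) = step (μsign (n div d) ≟ₛ s)
    where
    Ls  = signed n s L
    Ls′ = signed n (opposite s) L
    step : Dec (μsign (n div d) ≡ s) →
           F (signed n s (d ∷ L)) ⊛ inv (F (signed n (opposite s) (d ∷ L))) ≈ E d ⊛ ∏E L
    step (yes μ≡s) = begin
      F (signed n s (d ∷ L)) ⊛ inv (F (signed n (opposite s) (d ∷ L)))
        ≡⟨ cong₂ (λ M M′ → F M ⊛ inv (F M′)) (signed-accept n {d = d} {L = L} μ≡s) (signed-reject n {d = d} {L = L} (≡⇒≢opposite μ≡s)) ⟩
      (fac d ⊛ F Ls) ⊛ inv (F Ls′)
        ≈⟨ ⊛-assoc (fac d) (F Ls) (inv (F Ls′)) ⟩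
      fac d ⊛ (F Ls ⊛ inv (F Ls′))
        ≈⟨ ⊛-congʳ (fac d) (quotient≈∏E L≥1) ⟩
      fac d ⊛ ∏E L
        ≡⟨ cong (_⊛ ∏E L) (E-accept d μ≡s) ⟨
      E d ⊛ ∏E L  ∎
      where open ≈-Reasoning
    step (no μ≢s) = begin
      F (signed n s (d ∷ L)) ⊛ inv (F (signed n (opposite s) (d ∷ L)))
        ≡⟨ cong₂ (λ M M′ → F M ⊛ inv (F M′)) (signed-reject n {d = d} {L = L} μ≢s) (signed-accept n {d = d} {L = L} (≢⇒opposite μ≢s)) ⟩
      F Ls ⊛ inv (fac d ⊛ F Ls′)
        ≈⟨ ⊛-congʳ (F Ls) (inv-⊛ {fac d} {F Ls′} (IsUnit-fac d d≥1) (IsUnit-F (AllP.filter⁺ _ L≥1))) ⟩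
      F Ls ⊛ (inv (fac d) ⊛ inv (F Ls′))
        ≈⟨ ⊛-swap (F Ls) (inv (fac d)) (inv (F Ls′)) ⟩
      inv (fac d) ⊛ (F Ls ⊛ inv (F Ls′))
        ≈⟨ ⊛-congʳ (inv (fac d)) (quotient≈∏E L≥1) ⟩
      inv (fac d) ⊛ ∏E L
        ≡⟨ cong (_⊛ ∏E L) (E-reject d μ≢s) ⟨
      E d ⊛ ∏E L  ∎
      where open ≈-Reasoning

  ∏E-++ : ∀ L M → ∏E (L ++ M) ≈ ∏E L ⊛ ∏E M
  ∏E-++ []      M = ≈-sym (⊛-identityˡ (∏E M))
  ∏E-++ (d ∷ L) M = begin
    E d ⊛ ∏E (L ++ M)    ≈⟨ ⊛-congʳ (E d) (∏E-++ L M) ⟩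
    E d ⊛ (∏E L ⊛ ∏E M)  ≈⟨ ⊛-assoc (E d) (∏E L) (∏E M) ⟨
    (E d ⊛ ∏E L) ⊛ ∏E M  ∎
    where open ≈-Reasoning

  ∏E-↭ : ∀ {L M} → L ↭ M → ∏E L ≈ ∏E M
  ∏E-↭ Perm.refl          = ≈-refl
  ∏E-↭ (Perm.prep d L↭M)  = ⊛-congʳ (E d) (∏E-↭ L↭M)
  ∏E-↭ (Perm.swap d e L↭M) = ≈-trans (⊛-congʳ (E d) (⊛-congʳ (E e) (∏E-↭ L↭M))) (⊛-swap (E d) (E e) _)
  ∏E-↭ (Perm.trans L↭K K↭M) = ≈-trans (∏E-↭ L↭K) (∏E-↭ K↭M)

  -- Each factor has constant term −1.
  ∏E-constant : ∀ {L} → All (1 ≤_) L → ∏E L 0 ≡ negOnePow (length L)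
  ∏E-constant []                = refl
  ∏E-constant {d ∷ L} (d≥1 ∷ L≥1) = begin
    (E d ⊛ ∏E L) 0              ≡⟨ ⊛-zero (E d) (∏E L) ⟩
    E d 0 * ∏E L 0              ≡⟨ cong₂ _*_ (E-constant d d≥1) (∏E-constant L≥1) ⟩
    -1ℤ * negOnePow (length L)  ≡⟨ negOnePow-suc (length L) ⟨
    negOnePow (suc (length L))  ∎
    where open ≡-Reasoning

  quotient-constant : ∀ {L} → All (1 ≤_) L →
    (F (signed n s L) ⊛ inv (F (signed n (opposite s) L))) 0 ≡ negOnePow (length L)
  quotient-constant L≥1 = trans (quotient≈∏E L≥1 0) (∏E-constant L≥1)

  ∏E-high : ∀ u {L} → All (u <_) L → ∏E L ≈[ u ] const (negOnePow (length L))
  ∏E-high u []              = ≈[]-refl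
  ∏E-high u {d ∷ L} (u<d ∷ u<L) = begin
    E d ⊛ ∏E L                                ≈⟨ ⊛-cong[] (E-high u d u<d) (∏E-high u u<L) ⟩
    const -1ℤ ⊛ const (negOnePow (length L))  ≈⟨ ≈⇒≈[] (⊛-constˡ -1ℤ _) ⟩
    -1ℤ · const (negOnePow (length L))        ≈⟨ ≈⇒≈[] negate ⟩
    const (negOnePow (suc (length L)))        ∎
    where
    open ≈[]-Reasoning u
    negate : -1ℤ · const (negOnePow (length L)) ≈ const (negOnePow (suc (length L)))
    negate zero    = sym (negOnePow-suc (length L))
    negate (suc _) = refl

  ∏E-min : ∀ u {L} → Unique L → All (u ≤_) L → u ∈ L → ∏E L ≈[ u ] (- negOnePow (length L)) · E u
  ∏E-min u {_ ∷ L} (u∉L ∷ _) (_ ∷ u≤L) (here refl) = begin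
    E u ⊛ ∏E L                            ≈⟨ ⊛-cong[] {f = E u} ≈[]-refl (∏E-high u (above u∉L u≤L)) ⟩
    E u ⊛ const (negOnePow (length L))    ≈⟨ ≈⇒≈[] (≈-trans (⊛-comm (E u) _) (⊛-constˡ (negOnePow (length L)) (E u))) ⟩
    negOnePow (length L) · E u            ≈⟨ (λ i _ → cong (_* E u i) (sym (-⟦opposite⟧ (signPow (length L))))) ⟩
    (- negOnePow (suc (length L))) · E u  ∎
    where
    open ≈[]-Reasoning u
    above : ∀ {L} → All (u ≢_) L → All (u ≤_) L → All (u <_) L
    above []             []           = []
    above (u≢d ∷ u≢L) (u≤d ∷ u≤L) = ℕP.≤∧≢⇒< u≤d u≢d ∷ above u≢L u≤L
  ∏E-min u {d ∷ L} (d∉L ∷ unique) (u≤d ∷ u≤L) (there u∈L) = begin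
    E d ⊛ ∏E L                                    ≈⟨ ⊛-cong[] (E-high u d u<d) (∏E-min u unique u≤L u∈L) ⟩
    const -1ℤ ⊛ ((- negOnePow (length L)) · E u)  ≈⟨ ≈⇒≈[] (⊛-constˡ -1ℤ _) ⟩
    -1ℤ · ((- negOnePow (length L)) · E u)        ≈⟨ (λ i _ → sign-flip (negOnePow (length L)) (E u i)) ⟩
    (- (-1ℤ * negOnePow (length L))) · E u        ≈⟨ (λ i _ → cong (λ z → (- z) * E u i) (sym (negOnePow-suc (length L)))) ⟩
    (- negOnePow (suc (length L))) · E u          ∎
    where
    open ≈[]-Reasoning u
    u<d : u < d
    u<d = ℕP.≤∧≢⇒< u≤d (λ u≡d → All.lookup d∉L u∈L (sym u≡d))
    sign-flip : ∀ x e → -1ℤ * ((- x) * e) ≡ (- (-1ℤ * x)) * e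
    sign-flip = solve-∀

  factorisation : ∀ {D A B} → All (1 ≤_) D → All (1 ≤_) B → D ↭ n ∷ A ++ B →
    F (signed n s D) ⊛ F (signed n (opposite s) (n ∷ [])) ⊛ inv (F (signed n (opposite s) D))
      ≈ (F (signed n (opposite s) (n ∷ [])) ⊛ E n) ⊛ (∏E A ⊛ (F (signed n s B) ⊛ inv (F (signed n (opposite s) B))))
  factorisation {D} {A} {B} D≥1 B≥1 D↭ = begin
    F Ds ⊛ N ⊛ inv (F Ds′)     ≈⟨ ⊛-congˡ (inv (F Ds′)) (⊛-comm (F Ds) N) ⟩
    N ⊛ F Ds ⊛ inv (F Ds′)     ≈⟨ ⊛-assoc N (F Ds) (inv (F Ds′)) ⟩
    N ⊛ (F Ds ⊛ inv (F Ds′))   ≈⟨ ⊛-congʳ N (quotient≈∏E D≥1) ⟩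
    N ⊛ ∏E D                   ≈⟨ ⊛-congʳ N (∏E-↭ D↭) ⟩
    N ⊛ (E n ⊛ ∏E (A ++ B))    ≈⟨ ⊛-congʳ N (⊛-congʳ (E n) (∏E-++ A B)) ⟩
    N ⊛ (E n ⊛ (∏E A ⊛ ∏E B))  ≈⟨ ⊛-congʳ N (⊛-congʳ (E n) (⊛-congʳ (∏E A) (quotient≈∏E B≥1))) ⟨
    N ⊛ (E n ⊛ (∏E A ⊛ G))     ≈⟨ ⊛-assoc N (E n) (∏E A ⊛ G) ⟨
    (N ⊛ E n) ⊛ (∏E A ⊛ G)     ∎
    where
    open ≈-Reasoning
    N   = F (signed n (opposite s) (n ∷ []))
    Ds  = signed n s D
    Ds′ = signed n (opposite s) D
    G   = F (signed n s B) ⊛ inv (F (signed n (opposite s) B))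

μ-top : ∀ n → 1 ≤ n → μsign (n div n) ≡ pos
μ-top (suc m) _ = cong μsign (n/n≡1 (suc m))

-- The factor of the top divisor d = n: F_{{n}^∓} · E n is x^n − 1 if s = +
-- and 1 if s = −, hence ≡ −(±1) modulo x^(u+1) when u < n.
top-factor : ∀ n s u → 1 ≤ n → u < n →
  F (signed n (opposite s) (n ∷ [])) ⊛ SignedFactors.E n s n ≈[ u ] const (- ⟦ s ⟧)
top-factor n pos u n≥1 u<n = begin
  F (signed n neg (n ∷ [])) ⊛ E n  ≡⟨ cong₂ (λ M e → F M ⊛ e) (signed-reject n {d = n} {L = []} (≡⇒≢opposite (μ-top n n≥1))) (E-accept n (μ-top n n≥1)) ⟩
  one ⊛ fac n                      ≈⟨ ≈⇒≈[] (⊛-identityˡ (fac n)) ⟩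
  fac n                            ≈⟨ fac-high u n u<n ⟩
  const -1ℤ                        ∎
  where
  open SignedFactors n pos
  open ≈[]-Reasoning u
top-factor n neg u n≥1 u<n = ≈⇒≈[] (begin
  F (signed n pos (n ∷ [])) ⊛ E n  ≡⟨ cong₂ (λ M e → F M ⊛ e) (signed-accept n {d = n} {L = []} (μ-top n n≥1)) (E-reject n (≡⇒≢opposite (μ-top n n≥1))) ⟩
  (fac n ⊛ one) ⊛ inv (fac n)      ≈⟨ ⊛-congˡ (inv (fac n)) (⊛-identityʳ (fac n)) ⟩
  fac n ⊛ inv (fac n)              ≈⟨ inv-inverseʳ (fac n) (IsUnit-fac n n≥1) ⟩
  one                              ∎)
  where
  open SignedFactors n neg
  open ≈-Reasoning

module Closing (n : ℕ) (s : Sign) (u : ℕ) (G : Series) (σ : ℤ) (u≥1 : 1 ≤ u) (σG₀≡-1 : σ * G 0 ≡ -1ℤ) where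
  open SignedFactors n s

  E⊛G-accept : μsign (n div u) ≡ s → E u ⊛ G ≈[ u ] G 0 · xpow u ⊖ G
  E⊛G-accept μ≡s = begin
    E u ⊛ G           ≡⟨ cong (_⊛ G) (E-accept u μ≡s) ⟩
    fac u ⊛ G         ≈⟨ fac-⊛[] u G ⟩
    G 0 · xpow u ⊖ G  ∎
    where open ≈[]-Reasoning u

  E⊛G-reject : μsign (n div u) ≢ s → E u ⊛ G ≈[ u ] -1ℤ · (G ⊕ G 0 · xpow u)
  E⊛G-reject μ≢s = begin
    E u ⊛ G                     ≡⟨ cong (_⊛ G) (E-reject u μ≢s) ⟩
    inv (fac u) ⊛ G             ≈⟨ ⊛-cong[] (inv-fac-low u u≥1) ≈[]-refl ⟩
    (-1ℤ · (one ⊕ xpow u)) ⊛ G  ≈⟨ ≈⇒≈[] expand ⟩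
    -1ℤ · (G ⊕ xpow u ⊛ G)      ≈⟨ ·-cong[] -1ℤ (⊕-cong[] {f = G} ≈[]-refl (xpow-⊛ u G)) ⟩
    -1ℤ · (G ⊕ G 0 · xpow u)    ∎
    where
    open ≈[]-Reasoning u
    expand : (-1ℤ · (one ⊕ xpow u)) ⊛ G ≈ -1ℤ · (G ⊕ xpow u ⊛ G)
    expand m = trans (⊛-scalˡ -1ℤ (one ⊕ xpow u) G m) (cong (-1ℤ *_)
      (trans (⊛-distribʳ one (xpow u) G m) (cong (_+ (xpow u ⊛ G) m) (⊛-identityˡ G m))))

  scalars : ∀ t → const (- t) ⊛ ((- σ) · E u ⊛ G) ≈ (- t) · ((- σ) · (E u ⊛ G))
  scalars t m = trans (⊛-constˡ (- t) ((- σ) · E u ⊛ G) m) (cong ((- t) *_) (⊛-scalˡ (- σ) (E u) G m))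

  coefficient-accept : ∀ t X g → (- t) * ((- σ) * (G 0 * X + - g)) ≡ t * (- (σ * g) + - X)
  coefficient-accept t X g = begin
    (- t) * ((- σ) * (G 0 * X + - g))  ≡⟨ expand t σ (G 0) X g ⟩
    t * (- (σ * g) + (σ * G 0) * X)    ≡⟨ cong (λ c → t * (- (σ * g) + c * X)) σG₀≡-1 ⟩
    t * (- (σ * g) + -1ℤ * X)          ≡⟨ cong (λ z → t * (- (σ * g) + z)) (ℤP.-1*i≡-i X) ⟩
    t * (- (σ * g) + - X)              ∎
    where
    open ≡-Reasoning
    expand : ∀ t σ g₀ X g → (- t) * ((- σ) * (g₀ * X + - g)) ≡ t * (- (σ * g) + (σ * g₀) * X)
    expand = solve-∀

  coefficient-reject : ∀ t X g → (- t) * ((- σ) * (-1ℤ * (g + G 0 * X))) ≡ t * (- (σ * g) + X)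
  coefficient-reject t X g = begin
    (- t) * ((- σ) * (-1ℤ * (g + G 0 * X)))  ≡⟨ expand t σ (G 0) X g ⟩
    t * (- (σ * g) + - ((σ * G 0) * X))      ≡⟨ cong (λ c → t * (- (σ * g) + - (c * X))) σG₀≡-1 ⟩
    t * (- (σ * g) + - (-1ℤ * X))            ≡⟨ cong (λ z → t * (- (σ * g) + - z)) (ℤP.-1*i≡-i X) ⟩
    t * (- (σ * g) + - - X)                  ≡⟨ cong (λ z → t * (- (σ * g) + z)) (ℤP.neg-involutive X) ⟩
    t * (- (σ * g) + X)                      ∎
    where
    open ≡-Reasoning
    expand : ∀ t σ g₀ X g → (- t) * ((- σ) * (-1ℤ * (g + g₀ * X))) ≡ t * (- (σ * g) + - ((σ * g₀) * X))
    expand = solve-∀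

  closing : (μ? : Dec (μsign (n div u) ≡ s)) →
    const (- ⟦ s ⟧) ⊛ ((- σ) · E u ⊛ G) ≈[ u ]
      ⟦ s ⟧ · (if does μ? then ⊝ (σ · G) ⊖ xpow u else ⊝ (σ · G) ⊕ xpow u)
  closing (yes μ≡s) = begin
    const (- ⟦ s ⟧) ⊛ ((- σ) · E u ⊛ G)       ≈⟨ ≈⇒≈[] (scalars ⟦ s ⟧) ⟩
    (- ⟦ s ⟧) · ((- σ) · (E u ⊛ G))           ≈⟨ ·-cong[] (- ⟦ s ⟧) (·-cong[] (- σ) (E⊛G-accept μ≡s)) ⟩
    (- ⟦ s ⟧) · ((- σ) · (G 0 · xpow u ⊖ G))  ≈⟨ (λ i _ → coefficient-accept ⟦ s ⟧ (xpow u i) (G i)) ⟩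
    ⟦ s ⟧ · (⊝ (σ · G) ⊖ xpow u)              ∎
    where open ≈[]-Reasoning u
  closing (no μ≢s) = begin
    const (- ⟦ s ⟧) ⊛ ((- σ) · E u ⊛ G)               ≈⟨ ≈⇒≈[] (scalars ⟦ s ⟧) ⟩
    (- ⟦ s ⟧) · ((- σ) · (E u ⊛ G))                   ≈⟨ ·-cong[] (- ⟦ s ⟧) (·-cong[] (- σ) (E⊛G-reject μ≢s)) ⟩
    (- ⟦ s ⟧) · ((- σ) · (-1ℤ · (G ⊕ G 0 · xpow u)))  ≈⟨ (λ i _ → coefficient-reject ⟦ s ⟧ (xpow u i) (G i)) ⟩
    ⟦ s ⟧ · (⊝ (σ · G) ⊕ xpow u)                      ∎
    where open ≈[]-Reasoning u

≈[]⇒XPowDivides : ∀ {u f g} → f ≈[ u ] g → XPowDivides (suc u) (f ⊖ g)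
≈[]⇒XPowDivides {g = g} f≈g m (s≤s m≤u) = trans (cong (_+ - g m) (f≈g m m≤u)) (ℤP.+-inverseʳ (g m))

-- Proof outline: P splits as (F_{{n}^∓} E n) · ∏_{a∈A} E a · G; modulo x^(u+1)
-- the first factor is −(±1) and the middle one is −(−1)^|A| E u; finally
-- G₀ = (−1)^|B| with |A| + |B| + 1 = #divisors even gives (−1)^|A| G₀ = −1.
mainTheorem10 :
    (ps : List ℕ) → ¬ (ps ≡ []) → All Prime ps → All (λ p → ¬ (2 ∣ p)) ps → Linked _<_ ps →
    (n : ℕ) → n ≡ product ps →
    (s : Sign) →
    (A B : List ℕ) → Unique A → Unique B →
    (∀ d → d ∈ A → d ∉ B) →
    (∀ d → ((d ∈ A ⊎ d ∈ B) ⇔ ((d ∣ n) × (d ≢ n)))) →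
    ¬ (A ≡ []) →
    (∀ d → (∃[ b ] ((b ∈ B) × (d ∣ b))) →
       countMultiples d (signed n (opposite s) B) ≤ countMultiples d (signed n s B)) →
    (u : ℕ) → u ∈ A → (∀ a → a ∈ A → u ≤ a) →
    let P = F (signed n s (divisors n)) ⊛ F (signed n (opposite s) (n ∷ []))
              ⊛ inv (F (signed n (opposite s) (divisors n)))
        G = F (signed n s B) ⊛ inv (F (signed n (opposite s) B))
        base = ⊝ (negOnePow (length A) · G)
        R = ⟦ s ⟧ · (if does (μsign (n div u) ≟ₛ s)
                       then base ⊖ xpow u
                       else base ⊕ xpow u)
    in XPowDivides (suc u) (P ⊖ R)
mainTheorem10 ps ps≢[] primes _ increasing n n≡ s A B uniqueA uniqueB disjoint partition _ _ u u∈A u≤A =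
  ≈[]⇒XPowDivides (begin
    F Ds ⊛ N ⊛ inv (F Ds′)
      ≈⟨ ≈⇒≈[] (factorisation (divisors-positive n) B≥1 D↭) ⟩
    (N ⊛ E n) ⊛ (∏E A ⊛ G)
      ≈⟨ ⊛-cong[] (top-factor n s u n≥1 u<n) (⊛-cong[] (∏E-min u uniqueA (All.tabulate (u≤A _)) u∈A) ≈[]-refl) ⟩
    const (- ⟦ s ⟧) ⊛ ((- σA) · E u ⊛ G)
      ≈⟨ Closing.closing n s u G σA u≥1 σA·G₀≡-1 (μsign (n div u) ≟ₛ s) ⟩
    ⟦ s ⟧ · (if does (μsign (n div u) ≟ₛ s) then ⊝ (σA · G) ⊖ xpow u else ⊝ (σA · G) ⊕ xpow u)  ∎)
  where
  open SignedFactors n s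
  open ≈[]-Reasoning u
  N   = F (signed n (opposite s) (n ∷ []))
  Ds  = signed n s (divisors n)
  Ds′ = signed n (opposite s) (divisors n)
  G   = F (signed n s B) ⊛ inv (F (signed n (opposite s) B))
  σA  = negOnePow (length A)
  n≥1 : 1 ≤ n
  n≥1 = subst (1 ≤_) (sym n≡) (productOfPrimes≥1 primes)
  proper : ∀ {d} → d ∈ A ⊎ d ∈ B → d ∣ n × d ≢ n
  proper {d} = Equivalence.to (partition d)
  D↭ : divisors n ↭ n ∷ A ++ B
  D↭ = divisors↭ n≥1 uniqueA uniqueB disjoint partition
  B≥1 : All (1 ≤_) B
  B≥1 = All.tabulate (λ b∈B → divisor≥1 n≥1 (proj₁ (proper (inj₂ b∈B))))
  u≥1 : 1 ≤ u
  u≥1 = divisor≥1 n≥1 (proj₁ (proper (inj₁ u∈A)))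
  u<n : u < n
  u<n = ℕP.≤∧≢⇒< (∣⇒≤ {{ℕ.>-nonZero n≥1}} (proj₁ (proper (inj₁ u∈A)))) (proj₂ (proper (inj₁ u∈A)))
  not-square : ∀ d → d ℕ.* d ≢ n
  not-square d d²≡n = squarefree-not-square ps≢[] primes increasing d (trans d²≡n n≡)
  σA·G₀≡-1 : σA * G 0 ≡ -1ℤ
  σA·G₀≡-1 = trans (cong (σA *_) (quotient-constant B≥1)) (partition-parity {A = A} {B} n≥1 not-square D↭)
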